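{- Let $n$ be an even positive integer. The fractions in reduced form with numerator $n$ whose odd greedy expansion has length $2$ are exactly those of the form \[ \frac{n}{n\Bigl(\prod_{i=1}^s p_i^{\lceil v_{p_i}(r)/2\rceil}\Bigr)(1+2t)-r}, \] where $r$ is any odd positive integer that is coprime to $n$ and less than $2n$, where $p_1,\dotsc,p_s$ are the (distinct) prime divisors of $r$ (the product being $1$ if $r=1$), and where $t$ is any nonnegative integer.
   Context: Odd greedy expansion: given a positive rational number $q$, define $x_1,x_2,\dots$ recursively: writing $R_i=q-\sum_{j=1}^{i-1}1/x_j$, if $R_i\ge 1$ let $x_i=1$, and if $0<R_i<1$ let $x_i$ be the unique odd positive integer with $\frac{1}{x_i}\le R_i<\frac{1}{x_i-2}$; the process stops when the remainder is $0$. The $x_i$ are the denominators of the odd greedy expansion of $q$ and the number of terms is its length. For a prime $p$ and nonzero integer $n$, $v_p(n)$ is the exponent of the largest power of $p$ dividing $n$. -}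

module Defs where

open import Data.Nat as ℕ using (ℕ; zero; suc; _*_; _^_; ⌈_/2⌉; _≤_)
open import Data.Nat.Divisibility using (_∣_; _∣?_; divides)
open import Data.Nat.Primality using (prime?)
open import Data.Integer using (+_)
open import Data.Rational as ℚ using (ℚ; _/_; 0ℚ; 1ℚ; _-_)
open import Data.List using (List; upTo; filter; map)
open import Data.Nat.ListAction using (product)
open import Data.Product using (Σ; _×_; ∃; ∃₂)
open import Data.Sum using (_⊎_)
open import Relation.Nullary using (yes; no; ¬_)
open import Relation.Nullary.Decidable using (_×-dec_)
open import Relation.Binary.PropositionalEquality using (_≡_)

-- 1/x as a rational (for x = 0 we return 0; never used with x = 0 below)
recip : ℕ → ℚ
recip zero    = 0ℚ
recip (suc k) = + 1 / suc k

-- p-adic valuation v_p(n) (meaningful for p prime, n ≥ 1), computed with fuel n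
-- (v_p(n) ≤ n for p ≥ 2): repeatedly divide by p while p ∣ n.
valAux : ℕ → ℕ → ℕ → ℕ
valAux zero    p n = 0
valAux (suc f) p n with p ∣? n
... | yes (divides q _) = suc (valAux f p q)
... | no _              = 0

val : ℕ → ℕ → ℕ
val p n = valAux n p n

primeDivisors : ℕ → List ℕ
primeDivisors r = filter (λ p → prime? p ×-dec (p ∣? r)) (upTo (suc r))

P : ℕ → ℕ
P r = product (map (λ p → p ^ ⌈ val p r /2⌉) (primeDivisors r))

-- one step of the odd greedy algorithm: x is the odd greedy denominator for remainder R
-- (R ≥ 1 gives x = 1; 0 < R < 1 gives the unique odd x with 1/x ≤ R < 1/(x-2)).
OddGreedyStep : ℚ → ℕ → Set
OddGreedyStep R x =
  (1ℚ ℚ.≤ R × x ≡ 1)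
  ⊎ (0ℚ ℚ.< R × R ℚ.< 1ℚ × ¬ (2 ∣ x) × 3 ≤ x × recip x ℚ.≤ R × R ℚ.< recip (x ℕ.∸ 2))

OddGreedyLength2 : ℚ → Set
OddGreedyLength2 q = ∃₂ λ x₁ x₂ →
  0ℚ ℚ.< q × OddGreedyStep q x₁ ×
  0ℚ ℚ.< (q - recip x₁) × OddGreedyStep (q - recip x₁) x₂ ×
  (q - recip x₁) - recip x₂ ≡ 0ℚ

-- Write d = n x - r with x the first odd greedy denominator of n/d. The greedy choice of
-- x says exactly that x is odd and 0 <= r < 2n, and the expansion then stops after one more
-- term iff the remainder r/(dx) is a unit fraction 1/y with y odd, i.e. iff r y = d x.
-- As gcd(n, d) = 1 gives gcd(r, n) = 1 and n x^2 = r (x + y), the condition r y = d x is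
-- solvable iff r | x^2, and for odd x this says precisely that x = P(r) (1 + 2t), since
-- p^v | x^2 iff p^(ceil(v/2)) | x.

module Submission where

open import Defs
open import Data.Nat.Base hiding (_/_)
open import Data.Nat.Properties
open import Data.Nat.Divisibility
open import Data.Nat.Coprimality using (Coprime; coprime-divisor)
open import Data.Nat.Primality
open import Data.Nat.Primality.Factorisation using (factorise)
open import Data.Nat.ListAction using (product)
open import Data.Nat.ListAction.Properties using (∈⇒∣product)
open import Data.Nat.Tactic.RingSolver using (solve-∀)
open import Data.Integer using (+_)
import Data.Integer as ℤ
import Data.Integer.Properties as ℤ
open import Data.Rational using (_/_)
open import Data.Rational as ℚ using (0ℚ; _-_; toℚᵘ)
import Data.Rational.Properties as ℚ
open import Data.Rational.Unnormalised as ℚᵘ using (ℚᵘ; mkℚᵘ; *≡*; *≤*; *<*)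
import Data.Rational.Unnormalised.Properties as ℚᵘ
open import Algebra.Properties.Group ℚ.+-0-group using (x∙y⁻¹≈ε⇒x≈y; x≈y⇒x∙y⁻¹≈ε; //-rightDividesˡ; //-rightDividesʳ)
open import Data.List using (List; []; _∷_; map; upTo)
open import Data.List.Membership.Propositional using (_∈_)
open import Data.List.Membership.Propositional.Properties using (∈-map⁺; ∈-filter⁺; ∈-filter⁻; ∈-upTo⁺)
open import Data.List.Relation.Unary.All as All using (All; []; _∷_)
open import Data.List.Relation.Unary.All.Properties using (All¬⇒¬Any)
open import Data.List.Relation.Unary.Any using (here; there)
open import Data.List.Relation.Unary.AllPairs using ([]; _∷_)
open import Data.List.Relation.Unary.Unique.Propositional using (Unique)
import Data.List.Relation.Unary.Unique.Propositional.Properties as Unique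
open import Data.Product using (_×_; ∃; ∃₂; _,_; proj₁; proj₂; map₂)
open import Data.Sum using (inj₁; inj₂; [_,_])
open import Function using (_∘_; it)
open import Function.Bundles using (_⇔_; mk⇔; Equivalence)
import Function.Properties.Equivalence as ⇔
open import Relation.Nullary using (¬_; yes; no; contradiction)
open import Relation.Nullary.Decidable using (_×-dec_)
open import Relation.Unary using (Decidable)
open import Relation.Binary.PropositionalEquality hiding ([_])

open Equivalence

p^valAux∣ : ∀ f p n → p ^ valAux f p n ∣ n
p^valAux∣ zero    p n = 1∣ n
p^valAux∣ (suc f) p n with p ∣? n
... | yes (divides q refl) = subst (p * p ^ valAux f p q ∣_) (*-comm p q) (*-monoʳ-∣ p (p^valAux∣ f p q))
... | no _ = 1∣ n

p^suc[valAux]∤ : ∀ f p n → 2 ≤ p → 0 < n → n ≤ f → ¬ p ^ suc (valAux f p n) ∣ n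
p^suc[valAux]∤ zero p (suc n) 2≤p 0<n () h
p^suc[valAux]∤ (suc f) p n 2≤p 0<n n≤1+f h with p ∣? n
... | no p∤n = p∤n (subst (_∣ n) (*-identityʳ p) h)
... | yes (divides (suc q) refl) =
  p^suc[valAux]∤ f p (suc q) 2≤p z<s (≤-pred (<-≤-trans (m<m*n (suc q) p 2≤p) n≤1+f)) p^1+v∣q
  where
  instance
    p≢0 : NonZero p
    p≢0 = >-nonZero (<-≤-trans z<s 2≤p)
  p^1+v∣q : p ^ suc (valAux f p (suc q)) ∣ suc q
  p^1+v∣q = *-cancelˡ-∣ p (subst (p * p ^ suc (valAux f p (suc q)) ∣_) (*-comm (suc q) p) h)

p^val∣ : ∀ p n → p ^ val p n ∣ n
p^val∣ p n = p^valAux∣ n p n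

p^suc[val]∤ : ∀ {p n} → 2 ≤ p → 0 < n → ¬ p ^ suc (val p n) ∣ n
p^suc[val]∤ {p} {n} 2≤p 0<n = p^suc[valAux]∤ n p n 2≤p 0<n ≤-refl

^-monoʳ-∣ : ∀ p {a b} → a ≤ b → p ^ a ∣ p ^ b
^-monoʳ-∣ p {a} {b} a≤b = subst (λ c → p ^ a ∣ p ^ c) (m+[n∸m]≡n a≤b)
  (subst (p ^ a ∣_) (sym (^-distribˡ-+-* p a (b ∸ a))) (m∣m*n (p ^ (b ∸ a))))

n≤⌈n/2⌉+⌈n/2⌉ : ∀ n → n ≤ ⌈ n /2⌉ + ⌈ n /2⌉
n≤⌈n/2⌉+⌈n/2⌉ n = subst (_≤ ⌈ n /2⌉ + ⌈ n /2⌉) (⌊n/2⌋+⌈n/2⌉≡n n)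
  (+-monoˡ-≤ ⌈ n /2⌉ (⌊n/2⌋≤⌈n/2⌉ n))

prime⇒2≤ : ∀ {p} → Prime p → 2 ≤ p
prime⇒2≤ {p} pp = nonTrivial⇒n>1 p {{prime⇒nonTrivial pp}}

prime∤1 : ∀ {p} → Prime p → ¬ p ∣ 1
prime∤1 pp p∣1 = <⇒≢ (prime⇒2≤ pp) (sym (∣1⇒≡1 p∣1))

prime∣m*m⇒∣m : ∀ {p} m → Prime p → p ∣ m * m → p ∣ m
prime∣m*m⇒∣m m pp p∣m² with euclidsLemma m m pp p∣m²
... | inj₁ p∣m = p∣m
... | inj₂ p∣m = p∣m

p^v∣m*m⇒p^⌈v/2⌉∣m : ∀ {p} → Prime p → ∀ v m → p ^ v ∣ m * m → p ^ ⌈ v /2⌉ ∣ m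
p^v∣m*m⇒p^⌈v/2⌉∣m pp zero          m _ = 1∣ m
p^v∣m*m⇒p^⌈v/2⌉∣m pp (suc zero)    m h =
  subst (_∣ m) (sym (*-identityʳ _)) (prime∣m*m⇒∣m m pp (subst (_∣ m * m) (*-identityʳ _) h))
p^v∣m*m⇒p^⌈v/2⌉∣m {p} pp (suc (suc v)) m h
  with divides y refl ← prime∣m*m⇒∣m m pp (∣-trans (m∣m*n (p ^ suc v)) h) =
  subst (p * p ^ ⌈ v /2⌉ ∣_) (*-comm p y) (*-monoʳ-∣ p (p^v∣m*m⇒p^⌈v/2⌉∣m pp v y p^v∣y²))
  where
  instance
    p≢0 : NonZero p
    p≢0 = prime⇒nonZero pp
    p*p≢0 : NonZero (p * p)
    p*p≢0 = m*n≢0 p p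
  p^v∣y² : p ^ v ∣ y * y
  p^v∣y² = *-cancelˡ-∣ (p * p) (subst₂ _∣_ (sym (*-assoc p p (p ^ v))) (square-rearrange y p) h)
    where
    square-rearrange : ∀ y p → (y * p) * (y * p) ≡ (p * p) * (y * y)
    square-rearrange = solve-∀

p^a∣∧m∣∧p∤m⇒p^a*m∣ : ∀ {p} → Prime p → ∀ a {m x} → p ^ a ∣ x → m ∣ x → ¬ p ∣ m → p ^ a * m ∣ x
p^a∣∧m∣∧p∤m⇒p^a*m∣ pp zero {m} {x} _ m∣x _ = subst (_∣ x) (sym (*-identityˡ m)) m∣x
p^a∣∧m∣∧p∤m⇒p^a*m∣ {p} pp (suc a) {m} p^1+a∣x m∣x p∤m
  with divides c refl ← p^a∣∧m∣∧p∤m⇒p^a*m∣ pp a (∣-trans (n∣m*n p) p^1+a∣x) m∣x p∤m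
  with euclidsLemma c m pp p∣c*m
  where
  instance
    p^a≢0 : NonZero (p ^ a)
    p^a≢0 = m^n≢0 p a {{prime⇒nonZero pp}}
  p∣c*m : p ∣ c * m
  p∣c*m = *-cancelˡ-∣ (p ^ a) (subst₂ _∣_ (*-comm p (p ^ a)) (regroup c (p ^ a) m) p^1+a∣x)
    where
    regroup : ∀ c q m → c * (q * m) ≡ q * (c * m)
    regroup = solve-∀
... | inj₂ p∣m = contradiction p∣m p∤m
... | inj₁ (divides c′ refl) = divides c′ (regroup c′ p (p ^ a) m)
  where
  regroup : ∀ c p q m → c * p * (q * m) ≡ c * (p * q * m)
  regroup = solve-∀

prime∣prime^⇒≡ : ∀ {p q} → Prime p → Prime q → ∀ e → p ∣ q ^ e → p ≡ q
prime∣prime^⇒≡ pp pq zero    p∣1 = contradiction p∣1 (prime∤1 pp)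
prime∣prime^⇒≡ pp pq (suc e) p∣q^1+e with euclidsLemma _ _ pp p∣q^1+e
... | inj₂ p∣q^e = prime∣prime^⇒≡ pp pq e p∣q^e
... | inj₁ p∣q with prime⇒irreducible pq p∣q
...   | inj₁ refl = contradiction (∣-refl {1}) (prime∤1 pp)
...   | inj₂ p≡q  = p≡q

∏^ : List ℕ → (ℕ → ℕ) → ℕ
∏^ ps e = product (map (λ p → p ^ e p) ps)

p^e∣∏^ : ∀ {p ps} e → p ∈ ps → p ^ e p ∣ ∏^ ps e
p^e∣∏^ e p∈ps = ∈⇒∣product (∈-map⁺ _ p∈ps)

prime∣∏^⇒∈ : ∀ {p ps} e → Prime p → All Prime ps → p ∣ ∏^ ps e → p ∈ ps
prime∣∏^⇒∈ e pp []         p∣1 = contradiction p∣1 (prime∤1 pp)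
prime∣∏^⇒∈ {ps = q ∷ ps} e pp (pq ∷ pps) p∣∏ with euclidsLemma (q ^ e q) (∏^ ps e) pp p∣∏
... | inj₁ p∣q^e = here (prime∣prime^⇒≡ pp pq (e q) p∣q^e)
... | inj₂ p∣∏′  = there (prime∣∏^⇒∈ e pp pps p∣∏′)

∏^∣ : ∀ {ps x} e → All Prime ps → Unique ps → All (λ p → p ^ e p ∣ x) ps → ∏^ ps e ∣ x
∏^∣ {x = x} e []         []           []             = 1∣ x
∏^∣ {p ∷ _} e (pp ∷ pps) (p∉ps ∷ ups) (p^e∣x ∷ ∣xs) =
  p^a∣∧m∣∧p∤m⇒p^a*m∣ pp (e p) p^e∣x (∏^∣ e pps ups ∣xs)
    (All¬⇒¬Any p∉ps ∘ prime∣∏^⇒∈ e pp pps)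

∄prime∣⇒≡1 : ∀ c .{{_ : NonZero c}} → (∀ {p} → Prime p → ¬ p ∣ c) → c ≡ 1
∄prime∣⇒≡1 c ∄p with factorise c
... | record { factors = [] ; isFactorisation = c≡1 } = c≡1
... | record { factors = p ∷ ps ; isFactorisation = c≡∏ ; factorsPrime = pp ∷ _ } =
  contradiction (divides (product ps) (trans c≡∏ (*-comm p (product ps)))) (∄p pp)

module _ (r : ℕ) where

  prime∣r? : Decidable (λ p → Prime p × p ∣ r)
  prime∣r? p = prime? p ×-dec (p ∣? r)

  ∈-primeDivisors⁻ : ∀ {p} → p ∈ primeDivisors r → Prime p × p ∣ r
  ∈-primeDivisors⁻ = proj₂ ∘ ∈-filter⁻ prime∣r? {xs = upTo (suc r)}

  ∈-primeDivisors⁺ : ∀ {p} .{{_ : NonZero r}} → Prime p → p ∣ r → p ∈ primeDivisors r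
  ∈-primeDivisors⁺ pp p∣r = ∈-filter⁺ prime∣r? (∈-upTo⁺ (s≤s (∣⇒≤ p∣r))) (pp , p∣r)

  primeDivisors-prime : All Prime (primeDivisors r)
  primeDivisors-prime = All.tabulate (proj₁ ∘ ∈-primeDivisors⁻)

  primeDivisors-unique : Unique (primeDivisors r)
  primeDivisors-unique = Unique.filter⁺ prime∣r? (Unique.upTo⁺ (suc r))

  ∏^primeDivisors∣ : ∀ {x} e → (∀ {p} → Prime p → p ∣ r → p ^ e p ∣ x) → ∏^ (primeDivisors r) e ∣ x
  ∏^primeDivisors∣ e p^e∣x = ∏^∣ e primeDivisors-prime primeDivisors-unique
    (All.tabulate (λ p∈ → let pp , p∣r = ∈-primeDivisors⁻ p∈ in p^e∣x pp p∣r))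

  r≡∏^val : .{{_ : NonZero r}} → r ≡ ∏^ (primeDivisors r) (λ p → val p r)
  r≡∏^val with divides c r≡c*Q ← ∏^primeDivisors∣ (λ p → val p r) (λ {p} _ _ → p^val∣ p r) =
    trans r≡c*Q (trans (cong (_* Q) c≡1) (*-identityˡ Q))
    where
    Q : ℕ
    Q = ∏^ (primeDivisors r) (λ p → val p r)
    c≡1 : c ≡ 1
    -- a prime factor p of c would make p ^ suc (val p r) divide r
    c≡1 = ∄prime∣⇒≡1 c {{m*n≢0⇒m≢0 c {{subst NonZero r≡c*Q it}}}} λ {p} pp p∣c →
      let p∣r = ∣-trans p∣c (subst (c ∣_) (sym r≡c*Q) (m∣m*n Q)) in
      p^suc[val]∤ (prime⇒2≤ pp) (>-nonZero⁻¹ r)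
        (subst (p ^ suc (val p r) ∣_) (sym r≡c*Q)
          (*-pres-∣ p∣c (p^e∣∏^ (λ p → val p r) (∈-primeDivisors⁺ pp p∣r))))

r∣x*x⇒P∣x : ∀ {r x} → r ∣ x * x → P r ∣ x
r∣x*x⇒P∣x {r} {x} r∣x² = ∏^primeDivisors∣ r (λ p → ⌈ val p r /2⌉)
  (λ {p} pp _ → p^v∣m*m⇒p^⌈v/2⌉∣m pp (val p r) x (∣-trans (p^val∣ p r) r∣x²))

r∣P*P : ∀ r .{{_ : NonZero r}} → r ∣ P r * P r
r∣P*P r = subst (_∣ P r * P r) (sym (r≡∏^val r)) (∏^primeDivisors∣ r (λ p → val p r) p^val∣P*P)
  where
  p^val∣P*P : ∀ {p} → Prime p → p ∣ r → p ^ val p r ∣ P r * P r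
  p^val∣P*P {p} pp p∣r = ∣-trans (^-monoʳ-∣ p (n≤⌈n/2⌉+⌈n/2⌉ (val p r)))
    (subst (_∣ P r * P r) (sym (^-distribˡ-+-* p ⌈ val p r /2⌉ ⌈ val p r /2⌉)) (*-pres-∣ p^h∣P p^h∣P))
    where
    p^h∣P : p ^ ⌈ val p r /2⌉ ∣ P r
    p^h∣P = p^e∣∏^ (λ p → ⌈ val p r /2⌉) (∈-primeDivisors⁺ r pp p∣r)

P-odd : ∀ {r} → ¬ 2 ∣ r → ¬ 2 ∣ P r
P-odd {r} 2∤r 2∣P =
  2∤r (proj₂ (∈-primeDivisors⁻ r (prime∣∏^⇒∈ (λ p → ⌈ val p r /2⌉) prime[2] (primeDivisors-prime r) 2∣P)))

-- mkℚᵘ a k denotes a / (k + 1).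
module _ (a b k j : ℕ) where

  cross-≃ : (mkℚᵘ (+ a) k ℚᵘ.≃ mkℚᵘ (+ b) j) ⇔ (a * suc j ≡ b * suc k)
  cross-≃ = mk⇔
    (λ { (*≡* eq) → ℤ.+-injective (trans (ℤ.pos-* a (suc j)) (trans eq (sym (ℤ.pos-* b (suc k))))) })
    (λ eq → *≡* (trans (sym (ℤ.pos-* a (suc j))) (trans (cong +_ eq) (ℤ.pos-* b (suc k)))))

  cross-≤ : (mkℚᵘ (+ a) k ℚᵘ.≤ mkℚᵘ (+ b) j) ⇔ (a * suc j ≤ b * suc k)
  cross-≤ = mk⇔
    (λ { (*≤* le) → ℤ.drop‿+≤+ (subst₂ ℤ._≤_ (sym (ℤ.pos-* a (suc j))) (sym (ℤ.pos-* b (suc k))) le) })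
    (λ le → *≤* (subst₂ ℤ._≤_ (ℤ.pos-* a (suc j)) (ℤ.pos-* b (suc k)) (ℤ.+≤+ le)))

  cross-< : (mkℚᵘ (+ a) k ℚᵘ.< mkℚᵘ (+ b) j) ⇔ (a * suc j < b * suc k)
  cross-< = mk⇔
    (λ { (*<* lt) → ℤ.drop‿+<+ (subst₂ ℤ._<_ (sym (ℤ.pos-* a (suc j))) (sym (ℤ.pos-* b (suc k))) lt) })
    (λ lt → *<* (subst₂ ℤ._<_ (ℤ.pos-* a (suc j)) (ℤ.pos-* b (suc k)) (ℤ.+<+ lt)))

toℚᵘ-/ : ∀ a k → toℚᵘ (+ a / suc k) ℚᵘ.≃ mkℚᵘ (+ a) k
toℚᵘ-/ a k = ℚ.toℚᵘ-fromℚᵘ (mkℚᵘ (+ a) k)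

module _ {p p′ q q′ : ℚᵘ} (p≃p′ : p ℚᵘ.≃ p′) (q≃q′ : q ℚᵘ.≃ q′) where

  ≃ᵘ-cong : (p ℚᵘ.≃ q) ⇔ (p′ ℚᵘ.≃ q′)
  ≃ᵘ-cong = mk⇔ (λ p≃q → ℚᵘ.≃-trans (ℚᵘ.≃-sym p≃p′) (ℚᵘ.≃-trans p≃q q≃q′))
                 (λ p′≃q′ → ℚᵘ.≃-trans p≃p′ (ℚᵘ.≃-trans p′≃q′ (ℚᵘ.≃-sym q≃q′)))

  ≤ᵘ-cong : (p ℚᵘ.≤ q) ⇔ (p′ ℚᵘ.≤ q′)
  ≤ᵘ-cong = mk⇔ (ℚᵘ.≤-respʳ-≃ q≃q′ ∘ ℚᵘ.≤-respˡ-≃ p≃p′)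
                 (ℚᵘ.≤-respʳ-≃ (ℚᵘ.≃-sym q≃q′) ∘ ℚᵘ.≤-respˡ-≃ (ℚᵘ.≃-sym p≃p′))

  <ᵘ-cong : (p ℚᵘ.< q) ⇔ (p′ ℚᵘ.< q′)
  <ᵘ-cong = mk⇔ (ℚᵘ.<-respʳ-≃ q≃q′ ∘ ℚᵘ.<-respˡ-≃ p≃p′)
                 (ℚᵘ.<-respʳ-≃ (ℚᵘ.≃-sym q≃q′) ∘ ℚᵘ.<-respˡ-≃ (ℚᵘ.≃-sym p≃p′))

/≤/⇔ : ∀ a b k j → (+ a / suc k ℚ.≤ + b / suc j) ⇔ (a * suc j ≤ b * suc k)
/≤/⇔ a b k j = ⇔.trans (mk⇔ ℚ.toℚᵘ-mono-≤ ℚ.toℚᵘ-cancel-≤)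
  (⇔.trans (≤ᵘ-cong (toℚᵘ-/ a k) (toℚᵘ-/ b j)) (cross-≤ a b k j))

/</⇔ : ∀ a b k j → (+ a / suc k ℚ.< + b / suc j) ⇔ (a * suc j < b * suc k)
/</⇔ a b k j = ⇔.trans (mk⇔ ℚ.toℚᵘ-mono-< ℚ.toℚᵘ-cancel-<)
  (⇔.trans (<ᵘ-cong (toℚᵘ-/ a k) (toℚᵘ-/ b j)) (cross-< a b k j))

toℚᵘ-recip+recip : ∀ i j →
  toℚᵘ (recip (suc i) ℚ.+ recip (suc j)) ℚᵘ.≃ mkℚᵘ (+ (suc j + suc i)) (j + i * suc j)
toℚᵘ-recip+recip i j = ℚᵘ.≃-trans (ℚ.toℚᵘ-homo-+ (recip (suc i)) (recip (suc j)))
  (ℚᵘ.≃-trans (ℚᵘ.+-cong (toℚᵘ-/ 1 i) (toℚᵘ-/ 1 j)) (*≡* (cong (ℤ._* + suc (j + i * suc j)) numerator)))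
  where
  numerator : + 1 ℤ.* + suc j ℤ.+ + 1 ℤ.* + suc i ≡ + (suc j + suc i)
  numerator = trans (cong₂ ℤ._+_ (ℤ.*-identityˡ (+ suc j)) (ℤ.*-identityˡ (+ suc i)))
                    (sym (ℤ.pos-+ (suc j) (suc i)))

/≡recip+recip⇔ : ∀ n k i j → (+ n / suc k ≡ recip (suc i) ℚ.+ recip (suc j))
                                ⇔ (n * (suc i * suc j) ≡ (suc j + suc i) * suc k)
/≡recip+recip⇔ n k i j = ⇔.trans (mk⇔ ℚ.toℚᵘ-cong ℚ.toℚᵘ-injective)
  (⇔.trans (≃ᵘ-cong (toℚᵘ-/ n k) (toℚᵘ-recip+recip i j)) (cross-≃ n (suc j + suc i) k (j + i * suc j)))

n*[3+m]≡n*[1+m]+2*n : ∀ n m → n * (3 + m) ≡ n * (1 + m) + 2 * n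
n*[3+m]≡n*[1+m]+2*n = solve-∀

oddGreedyStep⇔ : ∀ {n k x} → 0 < n →
  OddGreedyStep (+ n / suc k) x ⇔ (¬ 2 ∣ x × suc k ≤ n * x × n * x < suc k + 2 * n)
oddGreedyStep⇔ {n} {k} {x} 0<n = mk⇔ ⇒ (⇐ x)
  where
  ⇒ : OddGreedyStep (+ n / suc k) x → ¬ 2 ∣ x × suc k ≤ n * x × n * x < suc k + 2 * n
  ⇒ (inj₁ (1≤q , refl)) = prime∤1 prime[2] , subst (_≤ n * 1) (*-identityˡ (suc k)) (to (/≤/⇔ 1 n 0 k) 1≤q) ,
    s≤s (≤-trans (≤-reflexive (*-identityʳ n)) (≤-trans (m≤n*m n 2) (m≤n+m (2 * n) k)))
  ⇒ (inj₂ (_ , _ , 2∤x , s≤s (s≤s (s≤s {n = m} _)) , 1/x≤q , q<1/[x-2])) =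
    2∤x , subst (_≤ n * x) (*-identityˡ (suc k)) (to (/≤/⇔ 1 n (2 + m) k) 1/x≤q) ,
    subst (_< suc k + 2 * n) (sym (n*[3+m]≡n*[1+m]+2*n n m))
      (+-monoˡ-< (2 * n) (subst (n * suc m <_) (*-identityˡ (suc k)) (to (/</⇔ n 1 k m) q<1/[x-2])))
  ⇐ : ∀ x → ¬ 2 ∣ x × suc k ≤ n * x × n * x < suc k + 2 * n → OddGreedyStep (+ n / suc k) x
  ⇐ 0 (2∤0 , _) = contradiction (2 ∣0) 2∤0
  ⇐ 1 (_ , d≤n*1 , _) = inj₁ (from (/≤/⇔ 1 n 0 k) (subst (_≤ n * 1) (sym (*-identityˡ (suc k))) d≤n*1) , refl)
  ⇐ 2 (2∤2 , _) = contradiction ∣-refl 2∤2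
  ⇐ x@(suc (suc (suc m))) (2∤x , d≤nx , nx<d+2n) =
    inj₂ (from (/</⇔ 0 n 0 k) (subst (0 <_) (sym (*-identityʳ n)) 0<n) ,
          from (/</⇔ n 1 k 0) (subst₂ _<_ (sym (*-identityʳ n)) (sym (*-identityˡ (suc k)))
                                 (≤-<-trans (m≤m*n n (suc m)) n[1+m]<d)) ,
          2∤x , s≤s (s≤s (s≤s z≤n)) ,
          from (/≤/⇔ 1 n (2 + m) k) (subst (_≤ n * x) (sym (*-identityˡ (suc k))) d≤nx) ,
          from (/</⇔ n 1 k m) (subst (n * suc m <_) (sym (*-identityˡ (suc k))) n[1+m]<d))
    where
    n[1+m]<d : n * suc m < suc k
    n[1+m]<d = +-cancelʳ-< (2 * n) (n * suc m) (suc k) (subst (_< suc k + 2 * n) (n*[3+m]≡n*[1+m]+2*n n m) nx<d+2n)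

-- d + r = n x and r y = d x say that n/d - 1/x = r/(d x) = 1/y.
OddGreedyPair : ℕ → ℕ → Set
OddGreedyPair n d = ∃₂ λ x y → ∃ λ r →
  ¬ 2 ∣ x × ¬ 2 ∣ y × r < 2 * n × d + r ≡ n * x × r * y ≡ d * x

+-cancelˡ-<⇔ : ∀ {d r m b} → d + r ≡ m → (r < b ⇔ m < d + b)
+-cancelˡ-<⇔ {d} refl = mk⇔ (+-monoʳ-< d) (+-cancelˡ-< d _ _)

unitFractionSum⇔ : ∀ {n d r x y} → d + r ≡ n * x → (n * (y * x) ≡ (x + y) * d ⇔ r * y ≡ d * x)
unitFractionSum⇔ {n} {d} {r} {x} {y} d+r≡nx = mk⇔
  (λ eq → +-cancelˡ-≡ (d * y) _ _ (trans left-side (trans eq right-side)))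
  (λ eq → trans (sym left-side) (trans (cong (_+_ (d * y)) eq) (sym right-side)))
  where
  left-side : d * y + r * y ≡ n * (y * x)
  left-side = begin
    d * y + r * y  ≡⟨ *-distribʳ-+ y d r ⟨
    (d + r) * y    ≡⟨ cong (_* y) d+r≡nx ⟩
    n * x * y      ≡⟨ *-assoc n x y ⟩
    n * (x * y)    ≡⟨ cong (n *_) (*-comm x y) ⟩
    n * (y * x)    ∎
    where open ≡-Reasoning
  right-side : (x + y) * d ≡ d * y + d * x
  right-side = trans (*-comm (x + y) d) (trans (*-distribˡ-+ d x y) (+-comm (d * x) (d * y)))

oddGreedyLength2⇒ : ∀ {n k} → 0 < n → OddGreedyLength2 (+ n / suc k) → OddGreedyPair n (suc k)
oddGreedyLength2⇒ 0<n (x , zero , _ , _ , 0<R , _ , R-0≡0) =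
  contradiction (subst (0ℚ ℚ.<_) (x∙y⁻¹≈ε⇒x≈y _ _ R-0≡0) 0<R) (ℚ.<-irrefl refl)
oddGreedyLength2⇒ 0<n (zero , _ , _ , step₁ , _) = contradiction (2 ∣0) (proj₁ (to (oddGreedyStep⇔ 0<n) step₁))
oddGreedyLength2⇒ {n} {k} 0<n (x@(suc i) , y@(suc j) , _ , step₁ , 0<R , step₂ , R-1/y≡0) =
  x , y , r , 2∤x , 2∤y , from (+-cancelˡ-<⇔ {suc k} {r} d+r≡nx) nx<d+2n , d+r≡nx ,
  to (unitFractionSum⇔ {n} {suc k} {r} {x} {y} d+r≡nx) (to (/≡recip+recip⇔ n k j i) q≡1/y+1/x)
  where
  R≡1/y : + n / suc k - recip x ≡ recip y
  R≡1/y = x∙y⁻¹≈ε⇒x≈y _ _ R-1/y≡0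
  q≡1/y+1/x : + n / suc k ≡ recip y ℚ.+ recip x
  q≡1/y+1/x = trans (sym (//-rightDividesˡ (recip x) (+ n / suc k))) (cong (ℚ._+ recip x) R≡1/y)
  2∤y : ¬ 2 ∣ y
  2∤y = proj₁ (to (oddGreedyStep⇔ {1} {j} z<s) (subst (λ R → OddGreedyStep R y) R≡1/y step₂))
  bounds : ¬ 2 ∣ x × suc k ≤ n * x × n * x < suc k + 2 * n
  bounds = to (oddGreedyStep⇔ 0<n) step₁
  2∤x : ¬ 2 ∣ x
  2∤x = proj₁ bounds
  nx<d+2n : n * x < suc k + 2 * n
  nx<d+2n = proj₂ (proj₂ bounds)
  r : ℕ
  r = proj₁ (m≤n⇒∃[o]m+o≡n (proj₁ (proj₂ bounds)))
  d+r≡nx : suc k + r ≡ n * x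
  d+r≡nx = proj₂ (m≤n⇒∃[o]m+o≡n (proj₁ (proj₂ bounds)))

oddGreedyLength2⇐ : ∀ {n k} → 0 < n → OddGreedyPair n (suc k) → OddGreedyLength2 (+ n / suc k)
oddGreedyLength2⇐ 0<n (zero , _ , _ , 2∤0 , _) = contradiction (2 ∣0) 2∤0
oddGreedyLength2⇐ 0<n (_ , zero , _ , _ , 2∤0 , _) = contradiction (2 ∣0) 2∤0
oddGreedyLength2⇐ {n} {k} 0<n (x@(suc i) , y@(suc j) , r , 2∤x , 2∤y , r<2n , d+r≡nx , ry≡dx) =
  x , y , from (/</⇔ 0 n 0 k) (subst (0 <_) (sym (*-identityʳ n)) 0<n) ,
  from (oddGreedyStep⇔ 0<n)
    (2∤x , subst (suc k ≤_) d+r≡nx (m≤m+n (suc k) r) , to (+-cancelˡ-<⇔ {suc k} {r} d+r≡nx) r<2n) ,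
  subst (0ℚ ℚ.<_) (sym R≡1/y) (from (/</⇔ 0 1 0 j) z<s) ,
  subst (λ R → OddGreedyStep R y) (sym R≡1/y)
    (from (oddGreedyStep⇔ {1} {j} z<s) (2∤y , ≤-reflexive (sym (*-identityˡ y)) , to (+-cancelˡ-<⇔ {y} {0} refl) z<s)) ,
  x≈y⇒x∙y⁻¹≈ε R≡1/y
  where
  q≡1/y+1/x : + n / suc k ≡ recip y ℚ.+ recip x
  q≡1/y+1/x = from (/≡recip+recip⇔ n k j i) (from (unitFractionSum⇔ {n} {suc k} {r} {x} {y} d+r≡nx) ry≡dx)
  R≡1/y : + n / suc k - recip x ≡ recip y
  R≡1/y = trans (cong (_- recip x) q≡1/y+1/x) (//-rightDividesʳ (recip x) (recip y))

∣-summandʳ : ∀ {i a b n x} → a + b ≡ n * x → i ∣ n → i ∣ a → i ∣ b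
∣-summandʳ {i} {x = x} a+b≡nx i∣n i∣a = ∣m+n∣m⇒∣n (subst (i ∣_) (sym a+b≡nx) (∣-trans i∣n (m∣m*n x))) i∣a

∣-summandˡ : ∀ {i a b n x} → a + b ≡ n * x → i ∣ n → i ∣ b → i ∣ a
∣-summandˡ {a = a} {b} a+b≡nx = ∣-summandʳ (trans (+-comm b a) a+b≡nx)

2∤1+2* : ∀ t → ¬ 2 ∣ 1 + 2 * t
2∤1+2* t 2∣1+2t = prime∤1 prime[2] (∣m+n∣m⇒∣n (subst (2 ∣_) (+-comm 1 (2 * t)) 2∣1+2t) (m∣m*n t))

2∤⇒≡1+2* : ∀ c → ¬ 2 ∣ c → ∃ λ t → c ≡ 1 + 2 * t
2∤⇒≡1+2* zero          2∤0   = contradiction (2 ∣0) 2∤0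
2∤⇒≡1+2* (suc zero)    _     = 0 , refl
2∤⇒≡1+2* (suc (suc c)) 2∤2+c with t , c≡1+2t ← 2∤⇒≡1+2* c (2∤2+c ∘ ∣m∣n⇒∣m+n ∣-refl) =
  suc t , trans (cong (_+_ 2) c≡1+2t) (shift t)
  where
  shift : ∀ t → 2 + (1 + 2 * t) ≡ 1 + 2 * (1 + t)
  shift = solve-∀

n*x*x≡[y+x]*r : ∀ n d r x y → d + r ≡ n * x → r * y ≡ d * x → n * (x * x) ≡ (y + x) * r
n*x*x≡[y+x]*r n d r x y d+r≡nx ry≡dx = begin
  n * (x * x)    ≡⟨ *-assoc n x x ⟨
  n * x * x      ≡⟨ cong (_* x) d+r≡nx ⟨
  (d + r) * x    ≡⟨ *-distribʳ-+ x d r ⟩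
  d * x + r * x  ≡⟨ cong (_+ r * x) ry≡dx ⟨
  r * y + r * x  ≡⟨ *-distribˡ-+ r y x ⟨
  r * (y + x)    ≡⟨ *-comm r (y + x) ⟩
  (y + x) * r    ∎
  where open ≡-Reasoning

r*[n*s∸x]≡d*x : ∀ n d r x s → d + r ≡ n * x → x * x ≡ s * r → r * (n * s ∸ x) ≡ d * x
r*[n*s∸x]≡d*x n d r x s d+r≡nx x²≡sr = begin
  r * (n * s ∸ x)        ≡⟨ *-distribˡ-∸ r (n * s) x ⟩
  r * (n * s) ∸ r * x    ≡⟨ cong (_∸ r * x) r*ns≡dx+rx ⟩
  d * x + r * x ∸ r * x  ≡⟨ m+n∸n≡m (d * x) (r * x) ⟩
  d * x                  ∎
  where
  open ≡-Reasoning
  r*ns≡dx+rx : r * (n * s) ≡ d * x + r * x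
  r*ns≡dx+rx = begin
    r * (n * s)    ≡⟨ rearrange r n s ⟩
    n * (s * r)    ≡⟨ cong (n *_) x²≡sr ⟨
    n * (x * x)    ≡⟨ *-assoc n x x ⟨
    n * x * x      ≡⟨ cong (_* x) d+r≡nx ⟨
    (d + r) * x    ≡⟨ *-distribʳ-+ x d r ⟩
    d * x + r * x  ∎
    where
    rearrange : ∀ r n s → r * (n * s) ≡ n * (s * r)
    rearrange = solve-∀

r∣x*x⇒x≡P*odd : ∀ {r x} → ¬ 2 ∣ x → r ∣ x * x → ∃ λ t → x ≡ P r * (1 + 2 * t)
r∣x*x⇒x≡P*odd {r} 2∤x r∣x*x
  with divides c x≡c*P ← r∣x*x⇒P∣x r∣x*x
  with t , c≡1+2t ← 2∤⇒≡1+2* c (2∤x ∘ subst (2 ∣_) (sym x≡c*P) ∘ ∣m⇒∣m*n (P r))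
  = t , trans x≡c*P (trans (cong (_* P r) c≡1+2t) (*-comm (1 + 2 * t) (P r)))

ExplicitForm : ℕ → ℕ → Set
ExplicitForm n d = ∃₂ λ r t → ¬ (2 ∣ r) × Coprime r n × r < 2 * n × d + r ≡ n * P r * (1 + 2 * t)

oddGreedyPair⇒explicitForm : ∀ {n d} → 2 ∣ n → Coprime n d → OddGreedyPair n d → ExplicitForm n d
oddGreedyPair⇒explicitForm {n} {d} 2∣n n⊥d (x , y , r , 2∤x , 2∤y , r<2n , d+r≡nx , ry≡dx) =
  r , t , 2∤r , r⊥n , r<2n , trans d+r≡nx (trans (cong (n *_) x≡P[1+2t]) (sym (*-assoc n (P r) (1 + 2 * t))))
  where
  2∤d : ¬ 2 ∣ d
  2∤d 2∣d with () ← n⊥d (2∣n , 2∣d)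
  2∤r : ¬ 2 ∣ r
  2∤r = 2∤d ∘ ∣-summandˡ d+r≡nx 2∣n
  r⊥n : Coprime r n
  r⊥n (i∣r , i∣n) = n⊥d (i∣n , ∣-summandˡ d+r≡nx i∣n i∣r)
  r∣x*x : r ∣ x * x
  r∣x*x = coprime-divisor r⊥n (divides (y + x) (n*x*x≡[y+x]*r n d r x y d+r≡nx ry≡dx))
  t : ℕ
  t = proj₁ (r∣x*x⇒x≡P*odd 2∤x r∣x*x)
  x≡P[1+2t] : x ≡ P r * (1 + 2 * t)
  x≡P[1+2t] = proj₂ (r∣x*x⇒x≡P*odd 2∤x r∣x*x)

explicitForm⇒oddGreedyPair : ∀ {n d} → 2 ∣ n → ExplicitForm n d → Coprime n d × OddGreedyPair n d
explicitForm⇒oddGreedyPair {n} {d} 2∣n (r , t , 2∤r , r⊥n , r<2n , d+r≡nPt) =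
  n⊥d , x , y , r , 2∤x , 2∤y , r<2n , d+r≡nx , ry≡dx
  where
  x : ℕ
  x = P r * (1 + 2 * t)
  d+r≡nx : d + r ≡ n * x
  d+r≡nx = trans d+r≡nPt (*-assoc n (P r) (1 + 2 * t))
  n⊥d : Coprime n d
  n⊥d (i∣n , i∣d) = r⊥n (∣-summandʳ d+r≡nx i∣n i∣d , i∣n)
  2∤d : ¬ 2 ∣ d
  2∤d = 2∤r ∘ ∣-summandʳ d+r≡nx 2∣n
  2∤x : ¬ 2 ∣ x
  2∤x 2∣x = [ P-odd 2∤r , 2∤1+2* t ] (euclidsLemma (P r) (1 + 2 * t) prime[2] 2∣x)
  instance
    r≢0 : NonZero r
    r≢0 = ≢-nonZero λ { refl → 2∤r (2 ∣0) }
  r∣x*x : r ∣ x * x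
  r∣x*x = ∣-trans (r∣P*P r)
    (subst (P r * P r ∣_) (rearrange (P r) (1 + 2 * t)) (m∣m*n ((1 + 2 * t) * (1 + 2 * t))))
    where
    rearrange : ∀ p u → (p * p) * (u * u) ≡ (p * u) * (p * u)
    rearrange = solve-∀
  y : ℕ
  y = n * quotient r∣x*x ∸ x
  ry≡dx : r * y ≡ d * x
  ry≡dx = r*[n*s∸x]≡d*x n d r x (quotient r∣x*x) d+r≡nx (m∣n⇒n≡quotient*m r∣x*x)
  2∤y : ¬ 2 ∣ y
  2∤y 2∣y = [ 2∤d , 2∤x ] (euclidsLemma d x prime[2] (subst (2 ∣_) ry≡dx (∣n⇒∣m*n r 2∣y)))

theorem2p3 : (n : ℕ) → 0 < n → 2 ∣ n → (d : ℕ) → .{{_ : NonZero d}} →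
    (Coprime n d × OddGreedyLength2 (+ n / d))
      ⇔ (∃₂ λ r t → ¬ (2 ∣ r) × Coprime r n × r < 2 * n ×
           d + r ≡ n * P r * (1 + 2 * t))
theorem2p3 n 0<n 2∣n zero {{d≢0}} = contradiction refl (≢-nonZero⁻¹ zero {{d≢0}})
theorem2p3 n 0<n 2∣n (suc k) = mk⇔
  (λ (n⊥d , length2) → oddGreedyPair⇒explicitForm 2∣n n⊥d (oddGreedyLength2⇒ 0<n length2))
  (map₂ (oddGreedyLength2⇐ 0<n) ∘ explicitForm⇒oddGreedyPair 2∣n)
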